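{- In IITT, for every context $\Gamma$, every neutral expression $N$, all sorts $s,s'$, and all $x,U,T,\star$ and sort annotations: (1) $\Gamma\vdash N=s$ does not hold; (2) $\Gamma\vdash N=(x\star U)\to^{s_1,s_2}T$ does not hold; (3) $\Gamma\vdash s=s'$ implies $s\equiv s'$; (4) $\Gamma\vdash s=(x\star U)\to^{s_1,s_2}T$ does not hold.
   Context: Irrelevant Intensional Type Theory (IITT) is defined as follows. Sorts are $\mathsf{Set}_k$ ($k\in\mathbb{N}$), with $\mathsf{Axiom}=\{(\mathsf{Set}_i,\mathsf{Set}_{i+1})\mid i\in\mathbb{N}\}$ and $\mathsf{Rule}=\{(\mathsf{Set}_i,\mathsf{Set}_j,\mathsf{Set}_{\max(i,j)})\mid i,j\in\mathbb{N}\}$. Annotations are $\star\in\{:,\div\}$ (relevant, irrelevant). Expressions: $t,u,T,U ::= s \mid (x\star U)\to^{s,s'}T \mid x \mid \lambda x\star U.\,t \mid t\star u$, where $(x\star U)\to^{s,s'}T$ is a relevant or irrelevant dependent function type annotated with the sort $s$ of its domain and $s'$ of its codomain, and $t\star u$ is relevant application (also written $t\,u$) or irrelevant application $t\div u$. Expressions are taken modulo $\alpha$-equivalence; $\equiv$ is syntactic identity; $[u/x]t$ is capture-avoiding substitution. Neutral expressions: $n,N ::= x\mid n\star u$. Contexts: $\Gamma ::= () \mid \Gamma.\,x\star T$ (variables distinct). Resurrection $\Gamma^{\oplus}$ replaces each binding $x\div T$ by $x:T$. Abbreviations: $\Gamma\vdash t\div T$ means $\Gamma^\oplus\vdash t:T$;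 $\Gamma\vdash t=t'\div T$ means $\Gamma\vdash t\div T$ and $\Gamma\vdash t'\div T$; $\Gamma\vdash T$ means $\Gamma\vdash T:s$ for some sort $s$; $\Gamma\vdash T=T'$ means $\Gamma\vdash T=T':s$ for some $s$. The judgements $\vdash\Gamma$, $\Gamma\vdash t:T$, $\Gamma\vdash t=t':T$ are defined mutually inductively by: (contexts) $\vdash()$; from $\vdash\Gamma$ and $\Gamma\vdash T$ infer $\vdash\Gamma.x\star T$. (typing) from $\vdash\Gamma$, $(s,s')\in\mathsf{Axiom}$ infer $\Gamma\vdash s:s'$; from $\Gamma\vdash U:s_1$, $\Gamma.x\star U\vdash T:s_2$, $(s_1,s_2,s_3)\in\mathsf{Rule}$ infer $\Gamma\vdash (x\star U)\to^{s_1,s_2}T:s_3$; from $\vdash\Gamma$ and $(x:U)\in\Gamma$ infer $\Gamma\vdash x:U$ (no variable rule for irrelevant bindings); from $\Gamma.x\star U\vdash t:T$ and $\Gamma\vdash (x\star U)\to^{s,s'}T$ infer $\Gamma\vdash \lambda x\star U.t:(x\star U)\to^{s,s'}T$; from $\Gamma\vdash t:(x\star U)\to^{s,s'}T$ and $\Gamma\vdash u\star U$ infer $\Gamma\vdash t\star u:[u/x]T$; from $\Gamma\vdash t:T$ and $\Gamma\vdash T=T'$ infer $\Gamma\vdash t:T'$. (equality) $\beta$: from $\Gamma.x\star U\vdash t:T$ and $\Gamma\vdash u\star U$ infer $\Gamma\vdash(\lambda x\star U.t)\star u=[u/x]t:[u/x]T$; $\eta$: from $\Gamma\vdash t:(x\star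 U)\to^{s,s'}T$ infer $\Gamma\vdash t=\lambda x\star U.(t\star x):(x\star U)\to^{s,s'}T$; reflexivity, symmetry, transitivity; from $\Gamma\vdash U=U':s_1$, $\Gamma.x\star U\vdash T=T':s_2$, $(s_1,s_2,s_3)\in\mathsf{Rule}$ infer $\Gamma\vdash (x\star U)\to^{s_1,s_2}T=(x\star U')\to^{s_1,s_2}T':s_3$; from $\Gamma\vdash U=U':s_1$, $\Gamma.x\star U\vdash T:s_2$, $\Gamma.x\star U\vdash t=t':T$ infer $\Gamma\vdash\lambda x\star U.t=\lambda x\star U'.t':(x\star U)\to^{s_1,s_2}T$; from $\Gamma\vdash t=t':(x\star U)\to^{s,s'}T$ and $\Gamma\vdash u=u'\star U$ infer $\Gamma\vdash t\star u=t'\star u':[u/x]T$; from $\Gamma\vdash t=t':T$ and $\Gamma\vdash T=T'$ infer $\Gamma\vdash t=t':T'$. -}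

module Defs where

-- Irrelevant Intensional Type Theory (IITT), with de Bruijn indices
-- (so expressions are automatically taken modulo α-equivalence and
--  ≡ on Exp is syntactic identity up to α).

open import Data.Nat using (ℕ; zero; suc; _⊔_)
open import Data.Product using (_×_; _,_)

data Ann : Set where
  rel : Ann   -- ':'  (relevant)
  irr : Ann   -- '÷'  (irrelevant)

-- Sorts Set_k are represented by their level k : ℕ.
-- Axiom = {(Set_i, Set_{i+1})}, Rule = {(Set_i, Set_j, Set_{max i j})}.

data Exp : Set where
  sort : ℕ → Exp
  pi   : Ann → ℕ → ℕ → Exp → Exp → Exp      -- pi ⋆ s s' U T = (x ⋆ U) →^{Set_s, Set_s'} T, T binds x
  var  : ℕ → Exp
  lam  : Ann → Exp → Exp → Exp              -- lam ⋆ U t = λ x ⋆ U. t, t binds x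
  app  : Ann → Exp → Exp → Exp

data Neutral : Exp → Set where
  ne-var : ∀ i → Neutral (var i)
  ne-app : ∀ {⋆ n} u → Neutral n → Neutral (app ⋆ n u)

liftᵣ : (ℕ → ℕ) → ℕ → ℕ
liftᵣ ρ zero    = zero
liftᵣ ρ (suc i) = suc (ρ i)

ren : (ℕ → ℕ) → Exp → Exp
ren ρ (sort k)       = sort k
ren ρ (pi a s s' U T) = pi a s s' (ren ρ U) (ren (liftᵣ ρ) T)
ren ρ (var i)        = var (ρ i)
ren ρ (lam a U t)    = lam a (ren ρ U) (ren (liftᵣ ρ) t)
ren ρ (app a t u)    = app a (ren ρ t) (ren ρ u)

wk : Exp → Exp
wk = ren suc

liftₛ : (ℕ → Exp) → ℕ → Exp
liftₛ σ zero    = var zero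
liftₛ σ (suc i) = wk (σ i)

sub : (ℕ → Exp) → Exp → Exp
sub σ (sort k)        = sort k
sub σ (pi a s s' U T) = pi a s s' (sub σ U) (sub (liftₛ σ) T)
sub σ (var i)         = σ i
sub σ (lam a U t)     = lam a (sub σ U) (sub (liftₛ σ) t)
sub σ (app a t u)     = app a (sub σ t) (sub σ u)

single : Exp → ℕ → Exp
single u zero    = u
single u (suc i) = var i

-- [u/x]t  where x is de Bruijn index 0 of t
_[_] : Exp → Exp → Exp
t [ u ] = sub (single u) t

-- Contexts Γ ::= () | Γ. x ⋆ T   (variable 0 = last binding)
infixl 5 _▸_
data Ctx : Set where
  ∅   : Ctx
  _▸_ : Ctx → Ann × Exp → Ctx

_⊕ : Ctx → Ctx
∅ ⊕            = ∅
(Γ ▸ (a , T)) ⊕ = (Γ ⊕) ▸ (rel , T)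

resAt : Ann → Ctx → Ctx
resAt rel Γ = Γ
resAt irr Γ = Γ ⊕

-- (x : U) ∈ Γ : a RELEVANT binding at index i with type U (weakened into Γ)
data _∋_∶_ : Ctx → ℕ → Exp → Set where
  here  : ∀ {Γ U} → (Γ ▸ (rel , U)) ∋ zero ∶ wk U
  there : ∀ {Γ b i U} → Γ ∋ i ∶ U → (Γ ▸ b) ∋ suc i ∶ wk U

infix 4 ⊢_ _⊢_∶_ _⊢_≣_∶_ _⊢_≣_∶[_]_

mutual
  data ⊢_ : Ctx → Set where
    ⊢∅ : ⊢ ∅
    ⊢▸ : ∀ {Γ a T s} → ⊢ Γ → Γ ⊢ T ∶ sort s → ⊢ (Γ ▸ (a , T))

  data _⊢_∶_ : Ctx → Exp → Exp → Set where
    t-sort : ∀ {Γ i} → ⊢ Γ → Γ ⊢ sort i ∶ sort (suc i)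
    t-pi   : ∀ {Γ a U T s₁ s₂} →
             Γ ⊢ U ∶ sort s₁ → (Γ ▸ (a , U)) ⊢ T ∶ sort s₂ →
             Γ ⊢ pi a s₁ s₂ U T ∶ sort (s₁ ⊔ s₂)
    t-var  : ∀ {Γ i U} → ⊢ Γ → Γ ∋ i ∶ U → Γ ⊢ var i ∶ U
    t-lam  : ∀ {Γ a U T t s s' s''} →
             (Γ ▸ (a , U)) ⊢ t ∶ T → Γ ⊢ pi a s s' U T ∶ sort s'' →
             Γ ⊢ lam a U t ∶ pi a s s' U T
    t-app  : ∀ {Γ a U T t u s s'} →
             Γ ⊢ t ∶ pi a s s' U T → resAt a Γ ⊢ u ∶ U →
             Γ ⊢ app a t u ∶ (T [ u ])
    t-conv : ∀ {Γ t T T' s} → Γ ⊢ t ∶ T → Γ ⊢ T ≣ T' ∶ sort s → Γ ⊢ t ∶ T'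

  data _⊢_≣_∶[_]_ : Ctx → Exp → Exp → Ann → Exp → Set where
    eq-rel : ∀ {Γ u u' U} → Γ ⊢ u ≣ u' ∶ U → Γ ⊢ u ≣ u' ∶[ rel ] U
    eq-irr : ∀ {Γ u u' U} → (Γ ⊕) ⊢ u ∶ U → (Γ ⊕) ⊢ u' ∶ U → Γ ⊢ u ≣ u' ∶[ irr ] U

  data _⊢_≣_∶_ : Ctx → Exp → Exp → Exp → Set where
    e-β     : ∀ {Γ a U T t u} →
              (Γ ▸ (a , U)) ⊢ t ∶ T → resAt a Γ ⊢ u ∶ U →
              Γ ⊢ app a (lam a U t) u ≣ (t [ u ]) ∶ (T [ u ])
    e-η     : ∀ {Γ a U T t s s'} →
              Γ ⊢ t ∶ pi a s s' U T →
              Γ ⊢ t ≣ lam a U (app a (wk t) (var zero)) ∶ pi a s s' U T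
    e-refl  : ∀ {Γ t T} → Γ ⊢ t ∶ T → Γ ⊢ t ≣ t ∶ T
    e-sym   : ∀ {Γ t t' T} → Γ ⊢ t ≣ t' ∶ T → Γ ⊢ t' ≣ t ∶ T
    e-trans : ∀ {Γ t t' t'' T} → Γ ⊢ t ≣ t' ∶ T → Γ ⊢ t' ≣ t'' ∶ T → Γ ⊢ t ≣ t'' ∶ T
    e-pi    : ∀ {Γ a U U' T T' s₁ s₂} →
              Γ ⊢ U ≣ U' ∶ sort s₁ → (Γ ▸ (a , U)) ⊢ T ≣ T' ∶ sort s₂ →
              Γ ⊢ pi a s₁ s₂ U T ≣ pi a s₁ s₂ U' T' ∶ sort (s₁ ⊔ s₂)
    e-lam   : ∀ {Γ a U U' T t t' s₁ s₂} →
              Γ ⊢ U ≣ U' ∶ sort s₁ → (Γ ▸ (a , U)) ⊢ T ∶ sort s₂ →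
              (Γ ▸ (a , U)) ⊢ t ≣ t' ∶ T →
              Γ ⊢ lam a U t ≣ lam a U' t' ∶ pi a s₁ s₂ U T
    e-app   : ∀ {Γ a U T t t' u u' s s'} →
              Γ ⊢ t ≣ t' ∶ pi a s s' U T → Γ ⊢ u ≣ u' ∶[ a ] U →
              Γ ⊢ app a t u ≣ app a t' u' ∶ (T [ u ])
    e-conv  : ∀ {Γ t t' T T' s} →
              Γ ⊢ t ≣ t' ∶ T → Γ ⊢ T ≣ T' ∶ sort s → Γ ⊢ t ≣ t' ∶ T'

-- Erase typed terms to untyped λ-terms: relevant abstractions and
-- applications are kept, irrelevant ones are dropped, and sorts and Π-types
-- become constants. A typed term uses its irrelevant variables only in
-- irrelevant positions, so every rule of judgemental equality becomes
-- βη-conversion of the erasures. Parallel β-reduction and η-reduction are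
-- each confluent and they commute, so βη-reduction is confluent
-- (Hindley–Rosen) and convertible terms have a common reduct. A constant
-- reduces only to itself and a variable applied to arguments keeps that
-- shape; hence a neutral term is never convertible to a sort or a Π-type, and
-- convertible sorts and Π-types carry the same constant.

module Submission where

open import Defs
open import Data.Nat using (ℕ; zero; suc)
open import Data.Nat.Properties using (suc-injective)
open import Data.Product using (_×_; _,_; -,_; ∃-syntax; ∃₂)
open import Function using (_∘_; id)
open import Level using (0ℓ)
open import Relation.Nullary using (¬_)
open import Relation.Binary.Core using (Rel)
open import Relation.Binary.Definitions using (_Respects_)
open import Relation.Binary.PropositionalEquality using (_≡_; _≢_; refl; sym; trans; cong; cong₂; _≗_; module ≡-Reasoning)
open import Relation.Binary.Construct.Closure.ReflexiveTransitive using (Star; ε; _◅_; _◅◅_; gmap; return)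
open import Relation.Binary.Construct.Closure.Reflexive using (ReflClosure)
open import Relation.Binary.Construct.Closure.Symmetric using (fwd; bwd)
open import Relation.Binary.Construct.Closure.Equivalence using (EqClosure)
open import Relation.Binary.Rewriting using (Confluent)
import Relation.Binary.Construct.Closure.Reflexive as Refl
import Relation.Binary.Construct.Closure.Equivalence as EqClosure

-- Abstract rewriting

module _ {A : Set} where

  ⁼⇒* : {R : Rel A 0ℓ} {a b : A} → ReflClosure R a b → Star R a b
  ⁼⇒* Refl.refl = ε
  ⁼⇒* Refl.[ r ]     = return r

  ≡⇒* : {R : Rel A 0ℓ} {a b : A} → a ≡ b → Star R a b
  ≡⇒* refl = ε

  star-respects : {R : Rel A 0ℓ} {P : A → Set} → P Respects R → P Respects Star R
  star-respects resp ε        = id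
  star-respects resp (r ◅ rs) = star-respects resp rs ∘ resp r

  Subcommutative : Rel A 0ℓ → Set
  Subcommutative R = ∀ {a b c} → R a b → R a c → ∃[ d ] ReflClosure R b d × ReflClosure R c d

  StronglyCommute : Rel A 0ℓ → Rel A 0ℓ → Set
  StronglyCommute S T = ∀ {a b c} → S a b → T a c → ∃[ d ] ReflClosure T b d × Star S c d

  Commute : Rel A 0ℓ → Rel A 0ℓ → Set
  Commute S T = ∀ {a b c} → Star S a b → Star T a c → ∃[ d ] Star T b d × Star S c d

  module _ {R : Rel A 0ℓ} (subcommutative : Subcommutative R) where

    subcommutative-strip : ∀ {a b c} → R a b → Star R a c → ∃[ d ] Star R b d × ReflClosure R c d
    subcommutative-strip r ε = -, ε , Refl.[ r ]
    subcommutative-strip r (r′ ◅ rs) with subcommutative r r′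
    ... | _ , bd , Refl.refl = -, ⁼⇒* bd ◅◅ rs , Refl.refl
    ... | _ , bd , Refl.[ r″ ] with subcommutative-strip r″ rs
    ...   | d , s , o = d , ⁼⇒* bd ◅◅ s , o

    subcommutative⇒confluent : Confluent R
    subcommutative⇒confluent ε q = -, q , ε
    subcommutative⇒confluent (r ◅ rs) q with subcommutative-strip r q
    ... | _ , s₁ , o₁ with subcommutative⇒confluent rs s₁
    ...   | d , s₂ , s₃ = d , s₂ , ⁼⇒* o₁ ◅◅ s₃

  module _ {S T : Rel A 0ℓ} (commute : StronglyCommute S T) where

    strongly-commute-strip : ∀ {a b c} → Star S a b → T a c → ∃[ d ] ReflClosure T b d × Star S c d
    strongly-commute-strip ε t = -, Refl.[ t ] , ε
    strongly-commute-strip (s ◅ ss) t with commute s t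
    ... | _ , Refl.refl , cs = -, Refl.refl , cs ◅◅ ss
    ... | _ , Refl.[ t′ ] , cs with strongly-commute-strip ss t′
    ...   | d , o , cs′ = d , o , cs ◅◅ cs′

    strongly-commute⇒commute : Commute S T
    strongly-commute⇒commute ss ε = -, ε , ss
    strongly-commute⇒commute ss (t ◅ ts) with strongly-commute-strip ss t
    ... | _ , o , cs with strongly-commute⇒commute cs ts
    ...   | d , td , sd = d , ⁼⇒* o ◅◅ td , sd

  hindley-rosen : {S T : Rel A 0ℓ} → Confluent S → Confluent T → Commute T S →
    Confluent (λ a c → ∃[ b ] Star S a b × Star T b c)
  hindley-rosen {S} {T} confluentS confluentT commute = subcommutative⇒confluent diamond
    where
    diamond : Subcommutative (λ a c → ∃[ b ] Star S a b × Star T b c)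
    diamond (_ , sb , tb) (_ , sc , tc) with confluentS sb sc
    ... | _ , be , ce with commute tb be | commute tc ce
    ... | f , bf , ef | g , cg , eg with confluentT ef eg
    ... | h , fh , gh = h , Refl.[ f , bf , fh ] , Refl.[ g , cg , gh ]

  confluent⇒churchRosser : {R : Rel A 0ℓ} → Confluent R → ∀ {a b} → EqClosure R a b → ∃[ c ] Star R a c × Star R b c
  confluent⇒churchRosser confluent ε = -, ε , ε
  confluent⇒churchRosser confluent (fwd r ◅ rs) with confluent⇒churchRosser confluent rs
  ... | c , xc , bc = c , r ◅ xc , bc
  confluent⇒churchRosser confluent (bwd r ◅ rs) with confluent⇒churchRosser confluent rs
  ... | c , xc , bc with confluent (return r) xc
  ...   | d , ad , cd = d , ad , bc ◅◅ cd

-- Untyped λ-terms with constants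

data Const : Set where
  sortᶜ   : ℕ → Const
  piᶜ     : Const
  erasedᶜ : Const

infix  9 #_
infixl 7 _·_
infix  5 ƛ_

data Term : Set where
  con : Const → Term
  #_  : ℕ → Term
  ƛ_  : Term → Term
  _·_ : Term → Term → Term

Subst : Set
Subst = ℕ → Term

infixr 5 _∷ₛ_
_∷ₛ_ : {B : Set} → B → (ℕ → B) → ℕ → B
(x ∷ₛ ρ) zero    = x
(x ∷ₛ ρ) (suc i) = ρ i

∷ₛ-cong : {B : Set} (x : B) {ρ ρ′ : ℕ → B} → ρ ≗ ρ′ → (x ∷ₛ ρ) ≗ (x ∷ₛ ρ′)
∷ₛ-cong x p zero    = refl
∷ₛ-cong x p (suc i) = p i

∘-∷ₛ : {B C : Set} (f : B → C) (x : B) (ρ : ℕ → B) → f ∘ (x ∷ₛ ρ) ≗ (f x ∷ₛ f ∘ ρ)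
∘-∷ₛ f x ρ zero    = refl
∘-∷ₛ f x ρ (suc i) = refl

∷ₛ-∘-liftᵣ : {B : Set} (x : B) (ρ : ℕ → B) (f : ℕ → ℕ) → (x ∷ₛ ρ) ∘ liftᵣ f ≗ (x ∷ₛ ρ ∘ f)
∷ₛ-∘-liftᵣ x ρ f zero    = refl
∷ₛ-∘-liftᵣ x ρ f (suc i) = refl

liftᵣ-cong : {f g : ℕ → ℕ} → f ≗ g → liftᵣ f ≗ liftᵣ g
liftᵣ-cong p zero    = refl
liftᵣ-cong p (suc i) = cong suc (p i)

liftᵣ-∘ : (f g : ℕ → ℕ) → liftᵣ f ∘ liftᵣ g ≗ liftᵣ (f ∘ g)
liftᵣ-∘ f g zero    = refl
liftᵣ-∘ f g (suc i) = refl

rename : (ℕ → ℕ) → Term → Term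
rename f (con c) = con c
rename f (# i)   = # f i
rename f (ƛ t)   = ƛ rename (liftᵣ f) t
rename f (t · u) = rename f t · rename f u

weaken : Term → Term
weaken = rename suc

⇑ : Subst → Subst
⇑ σ = # zero ∷ₛ weaken ∘ σ

subst : Subst → Term → Term
subst σ (con c) = con c
subst σ (# i)   = σ i
subst σ (ƛ t)   = ƛ subst (⇑ σ) t
subst σ (t · u) = subst σ t · subst σ u

infix 8 _[_]₀
_[_]₀ : Term → Term → Term
t [ u ]₀ = subst (u ∷ₛ #_) t

rename-cong : {f g : ℕ → ℕ} → f ≗ g → rename f ≗ rename g
rename-cong p (con c) = refl
rename-cong p (# i)   = cong #_ (p i)
rename-cong p (ƛ t)   = cong ƛ_ (rename-cong (liftᵣ-cong p) t)
rename-cong p (t · u) = cong₂ _·_ (rename-cong p t) (rename-cong p u)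

⇑-cong : {σ τ : Subst} → σ ≗ τ → ⇑ σ ≗ ⇑ τ
⇑-cong p = ∷ₛ-cong (# zero) (cong weaken ∘ p)

subst-cong : {σ τ : Subst} → σ ≗ τ → subst σ ≗ subst τ
subst-cong p (con c) = refl
subst-cong p (# i)   = p i
subst-cong p (ƛ t)   = cong ƛ_ (subst-cong (⇑-cong p) t)
subst-cong p (t · u) = cong₂ _·_ (subst-cong p t) (subst-cong p u)

rename-rename : ∀ f g t → rename f (rename g t) ≡ rename (f ∘ g) t
rename-rename f g (con c) = refl
rename-rename f g (# i)   = refl
rename-rename f g (ƛ t)   =
  cong ƛ_ (trans (rename-rename (liftᵣ f) (liftᵣ g) t) (rename-cong (liftᵣ-∘ f g) t))
rename-rename f g (t · u) = cong₂ _·_ (rename-rename f g t) (rename-rename f g u)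

subst-rename : ∀ σ f t → subst σ (rename f t) ≡ subst (σ ∘ f) t
subst-rename σ f (con c) = refl
subst-rename σ f (# i)   = refl
subst-rename σ f (ƛ t)   =
  cong ƛ_ (trans (subst-rename (⇑ σ) (liftᵣ f) t) (subst-cong (∷ₛ-∘-liftᵣ (# zero) (weaken ∘ σ) f) t))
subst-rename σ f (t · u) = cong₂ _·_ (subst-rename σ f t) (subst-rename σ f u)

rename-liftᵣ-weaken : ∀ f t → rename (liftᵣ f) (weaken t) ≡ weaken (rename f t)
rename-liftᵣ-weaken f t = trans (rename-rename (liftᵣ f) suc t) (sym (rename-rename suc f t))

rename-⇑ : ∀ f σ → rename (liftᵣ f) ∘ ⇑ σ ≗ ⇑ (rename f ∘ σ)
rename-⇑ f σ zero    = refl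
rename-⇑ f σ (suc i) = rename-liftᵣ-weaken f (σ i)

rename-subst : ∀ f σ t → rename f (subst σ t) ≡ subst (rename f ∘ σ) t
rename-subst f σ (con c) = refl
rename-subst f σ (# i)   = refl
rename-subst f σ (ƛ t)   =
  cong ƛ_ (trans (rename-subst (liftᵣ f) (⇑ σ) t) (subst-cong (rename-⇑ f σ) t))
rename-subst f σ (t · u) = cong₂ _·_ (rename-subst f σ t) (rename-subst f σ u)

subst-⇑-weaken : ∀ σ t → subst (⇑ σ) (weaken t) ≡ weaken (subst σ t)
subst-⇑-weaken σ t = trans (subst-rename (⇑ σ) suc t) (sym (rename-subst suc σ t))

subst-⇑ : ∀ τ σ → subst (⇑ τ) ∘ ⇑ σ ≗ ⇑ (subst τ ∘ σ)
subst-⇑ τ σ zero    = refl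
subst-⇑ τ σ (suc i) = subst-⇑-weaken τ (σ i)

subst-subst : ∀ τ σ t → subst τ (subst σ t) ≡ subst (subst τ ∘ σ) t
subst-subst τ σ (con c) = refl
subst-subst τ σ (# i)   = refl
subst-subst τ σ (ƛ t)   =
  cong ƛ_ (trans (subst-subst (⇑ τ) (⇑ σ) t) (subst-cong (subst-⇑ τ σ) t))
subst-subst τ σ (t · u) = cong₂ _·_ (subst-subst τ σ t) (subst-subst τ σ u)

⇑-id : ⇑ #_ ≗ #_
⇑-id zero    = refl
⇑-id (suc i) = refl

subst-id : ∀ t → subst #_ t ≡ t
subst-id (con c) = refl
subst-id (# i)   = refl
subst-id (ƛ t)   = cong ƛ_ (trans (subst-cong ⇑-id t) (subst-id t))
subst-id (t · u) = cong₂ _·_ (subst-id t) (subst-id u)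

weaken-[]₀ : ∀ t u → weaken t [ u ]₀ ≡ t
weaken-[]₀ t u = trans (subst-rename (u ∷ₛ #_) suc t) (subst-id t)

rename-liftᵣ-suc-[#0]₀ : ∀ t → rename (liftᵣ suc) t [ # zero ]₀ ≡ t
rename-liftᵣ-suc-[#0]₀ t =
  trans (subst-rename (# zero ∷ₛ #_) (liftᵣ suc) t) (trans (subst-cong pointwise t) (subst-id t))
  where
  pointwise : (# zero ∷ₛ #_) ∘ liftᵣ suc ≗ #_
  pointwise zero    = refl
  pointwise (suc i) = refl

rename-[]₀ : ∀ f t u → rename f (t [ u ]₀) ≡ rename (liftᵣ f) t [ rename f u ]₀
rename-[]₀ f t u = begin
  rename f (t [ u ]₀)                             ≡⟨ rename-subst f (u ∷ₛ #_) t ⟩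
  subst (rename f ∘ (u ∷ₛ #_)) t                  ≡⟨ subst-cong pointwise t ⟩
  subst ((rename f u ∷ₛ #_) ∘ liftᵣ f) t          ≡⟨ sym (subst-rename (rename f u ∷ₛ #_) (liftᵣ f) t) ⟩
  rename (liftᵣ f) t [ rename f u ]₀              ∎
  where
  open ≡-Reasoning
  pointwise : rename f ∘ (u ∷ₛ #_) ≗ (rename f u ∷ₛ #_) ∘ liftᵣ f
  pointwise zero    = refl
  pointwise (suc i) = refl

subst-[]₀ : ∀ σ t u → subst σ (t [ u ]₀) ≡ subst (⇑ σ) t [ subst σ u ]₀
subst-[]₀ σ t u = begin
  subst σ (t [ u ]₀)                              ≡⟨ subst-subst σ (u ∷ₛ #_) t ⟩
  subst (subst σ ∘ (u ∷ₛ #_)) t                   ≡⟨ subst-cong pointwise t ⟩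
  subst (subst (subst σ u ∷ₛ #_) ∘ ⇑ σ) t         ≡⟨ sym (subst-subst (subst σ u ∷ₛ #_) (⇑ σ) t) ⟩
  subst (⇑ σ) t [ subst σ u ]₀                    ∎
  where
  open ≡-Reasoning
  pointwise : subst σ ∘ (u ∷ₛ #_) ≗ subst (subst σ u ∷ₛ #_) ∘ ⇑ σ
  pointwise zero    = refl
  pointwise (suc i) = sym (weaken-[]₀ (σ i) (subst σ u))

rename-con⁻¹ : ∀ f t {c} → rename f t ≡ con c → t ≡ con c
rename-con⁻¹ f (con c) refl = refl
rename-con⁻¹ f (# i)   ()
rename-con⁻¹ f (ƛ t)   ()
rename-con⁻¹ f (t · u) ()

rename-#⁻¹ : ∀ f t {i} → rename f t ≡ # i → ∃[ j ] t ≡ # j × f j ≡ i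
rename-#⁻¹ f (con c) ()
rename-#⁻¹ f (# j)   refl = j , refl , refl
rename-#⁻¹ f (ƛ t)   ()
rename-#⁻¹ f (t · u) ()

rename-ƛ⁻¹ : ∀ f t {b} → rename f t ≡ ƛ b → ∃[ t₀ ] t ≡ ƛ t₀ × rename (liftᵣ f) t₀ ≡ b
rename-ƛ⁻¹ f (con c) ()
rename-ƛ⁻¹ f (# i)   ()
rename-ƛ⁻¹ f (ƛ t)   refl = t , refl , refl
rename-ƛ⁻¹ f (t · u) ()

rename-·⁻¹ : ∀ f t {b c} → rename f t ≡ b · c →
  ∃₂ λ t₁ t₂ → t ≡ t₁ · t₂ × rename f t₁ ≡ b × rename f t₂ ≡ c
rename-·⁻¹ f (con c) ()
rename-·⁻¹ f (# i)   ()
rename-·⁻¹ f (ƛ t)   ()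
rename-·⁻¹ f (t · u) refl = t , u , refl , refl , refl

-- (h′, g′) is a weak pullback of the cospan (g, h).
Pullback : (g h h′ g′ : ℕ → ℕ) → Set
Pullback g h h′ g′ = ∀ {i j} → g i ≡ h j → ∃[ k ] i ≡ h′ k × j ≡ g′ k

liftᵣ-pullback : ∀ {g h h′ g′} → Pullback g h h′ g′ → Pullback (liftᵣ g) (liftᵣ h) (liftᵣ h′) (liftᵣ g′)
liftᵣ-pullback pb {zero}  {zero}  refl = zero , refl , refl
liftᵣ-pullback pb {zero}  {suc j} ()
liftᵣ-pullback pb {suc i} {zero}  ()
liftᵣ-pullback pb {suc i} {suc j} e with pb (suc-injective e)
... | k , refl , refl = suc k , refl , refl

rename-pullback : ∀ {g h h′ g′} → Pullback g h h′ g′ →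
  ∀ w v → rename g w ≡ rename h v → ∃[ u ] w ≡ rename h′ u × v ≡ rename g′ u
rename-pullback pb (con c) v e with rename-con⁻¹ _ v (sym e)
... | refl = con c , refl , refl
rename-pullback pb (# i) v e with rename-#⁻¹ _ v (sym e)
... | j , refl , e′ with pb (sym e′)
...   | k , refl , refl = # k , refl , refl
rename-pullback pb (ƛ w) v e with rename-ƛ⁻¹ _ v (sym e)
... | v₀ , refl , e′ with rename-pullback (liftᵣ-pullback pb) w v₀ (sym e′)
...   | u , refl , refl = ƛ u , refl , refl
rename-pullback pb (w₁ · w₂) v e with rename-·⁻¹ _ v (sym e)
... | v₁ , v₂ , refl , e₁ , e₂ with rename-pullback pb w₁ v₁ (sym e₁) | rename-pullback pb w₂ v₂ (sym e₂)
...   | u₁ , refl , refl | u₂ , refl , refl = u₁ · u₂ , refl , refl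

suc-pullback : Pullback suc suc id id
suc-pullback e = -, suc-injective e , refl

weaken-injective : ∀ {a b} → weaken a ≡ weaken b → a ≡ b
weaken-injective {a} {b} e with rename-pullback suc-pullback a b e
... | _ , refl , refl = refl

rename-liftᵣ≡weaken⁻¹ : ∀ f w v → rename (liftᵣ f) w ≡ weaken v → ∃[ v₀ ] w ≡ weaken v₀ × v ≡ rename f v₀
rename-liftᵣ≡weaken⁻¹ f = rename-pullback pb
  where
  pb : Pullback (liftᵣ f) suc suc f
  pb {suc i} refl = i , refl , refl

liftᵣ≡zero⁻¹ : ∀ f {i} → liftᵣ f i ≡ zero → i ≡ zero
liftᵣ≡zero⁻¹ f {zero} _ = refl

-- Parallel β-reduction

infix 4 _⇒_ _⇒ₛ_
data _⇒_ : Rel Term 0ℓ where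
  ⇒-con : ∀ {c} → con c ⇒ con c
  ⇒-#   : ∀ {i} → # i ⇒ # i
  ⇒-ƛ   : ∀ {t t′} → t ⇒ t′ → ƛ t ⇒ ƛ t′
  ⇒-·   : ∀ {t t′ u u′} → t ⇒ t′ → u ⇒ u′ → t · u ⇒ t′ · u′
  ⇒-β   : ∀ {t t′ u u′} → t ⇒ t′ → u ⇒ u′ → (ƛ t) · u ⇒ t′ [ u′ ]₀

⇒-refl : ∀ t → t ⇒ t
⇒-refl (con c) = ⇒-con
⇒-refl (# i)   = ⇒-#
⇒-refl (ƛ t)   = ⇒-ƛ (⇒-refl t)
⇒-refl (t · u) = ⇒-· (⇒-refl t) (⇒-refl u)

⇒-≡ : ∀ {a b c} → a ⇒ b → b ≡ c → a ⇒ c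
⇒-≡ p refl = p

⇒-rename : ∀ f {t t′} → t ⇒ t′ → rename f t ⇒ rename f t′
⇒-rename f ⇒-con     = ⇒-con
⇒-rename f ⇒-#       = ⇒-#
⇒-rename f (⇒-ƛ p)   = ⇒-ƛ (⇒-rename (liftᵣ f) p)
⇒-rename f (⇒-· p q) = ⇒-· (⇒-rename f p) (⇒-rename f q)
⇒-rename f (⇒-β {t′ = t′} {u′ = u′} p q) =
  ⇒-≡ (⇒-β (⇒-rename (liftᵣ f) p) (⇒-rename f q)) (sym (rename-[]₀ f t′ u′))

_⇒ₛ_ : Subst → Subst → Set
σ ⇒ₛ τ = ∀ i → σ i ⇒ τ i

⇑-⇒ₛ : ∀ {σ τ} → σ ⇒ₛ τ → ⇑ σ ⇒ₛ ⇑ τ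
⇑-⇒ₛ p zero    = ⇒-#
⇑-⇒ₛ p (suc i) = ⇒-rename suc (p i)

⇒-subst : ∀ {σ τ} → σ ⇒ₛ τ → ∀ {t t′} → t ⇒ t′ → subst σ t ⇒ subst τ t′
⇒-subst s ⇒-con         = ⇒-con
⇒-subst s (⇒-# {i})     = s i
⇒-subst s (⇒-ƛ p)       = ⇒-ƛ (⇒-subst (⇑-⇒ₛ s) p)
⇒-subst s (⇒-· p q)     = ⇒-· (⇒-subst s p) (⇒-subst s q)
⇒-subst {τ = τ} s (⇒-β {t′ = t′} {u′ = u′} p q) =
  ⇒-≡ (⇒-β (⇒-subst (⇑-⇒ₛ s) p) (⇒-subst s q)) (sym (subst-[]₀ τ t′ u′))

⇒-[]₀ : ∀ {t t′ u u′} → t ⇒ t′ → u ⇒ u′ → t [ u ]₀ ⇒ t′ [ u′ ]₀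
⇒-[]₀ {u = u} {u′} p q = ⇒-subst u⇒u′ p
  where
  u⇒u′ : (u ∷ₛ #_) ⇒ₛ (u′ ∷ₛ #_)
  u⇒u′ zero    = q
  u⇒u′ (suc i) = ⇒-#

⇒-diamond : ∀ {t a b} → t ⇒ a → t ⇒ b → ∃[ c ] a ⇒ c × b ⇒ c
⇒-diamond ⇒-con ⇒-con = -, ⇒-con , ⇒-con
⇒-diamond ⇒-#   ⇒-#   = -, ⇒-# , ⇒-#
⇒-diamond (⇒-ƛ p) (⇒-ƛ q) with ⇒-diamond p q
... | c , r , s = ƛ c , ⇒-ƛ r , ⇒-ƛ s
⇒-diamond (⇒-· p₁ p₂) (⇒-· q₁ q₂) with ⇒-diamond p₁ q₁ | ⇒-diamond p₂ q₂
... | c₁ , r₁ , s₁ | c₂ , r₂ , s₂ = c₁ · c₂ , ⇒-· r₁ r₂ , ⇒-· s₁ s₂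
⇒-diamond (⇒-· (⇒-ƛ p₁) p₂) (⇒-β q₁ q₂) with ⇒-diamond p₁ q₁ | ⇒-diamond p₂ q₂
... | c₁ , r₁ , s₁ | c₂ , r₂ , s₂ = c₁ [ c₂ ]₀ , ⇒-β r₁ r₂ , ⇒-[]₀ s₁ s₂
⇒-diamond (⇒-β p₁ p₂) (⇒-· (⇒-ƛ q₁) q₂) with ⇒-diamond p₁ q₁ | ⇒-diamond p₂ q₂
... | c₁ , r₁ , s₁ | c₂ , r₂ , s₂ = c₁ [ c₂ ]₀ , ⇒-[]₀ r₁ r₂ , ⇒-β s₁ s₂
⇒-diamond (⇒-β p₁ p₂) (⇒-β q₁ q₂) with ⇒-diamond p₁ q₁ | ⇒-diamond p₂ q₂
... | c₁ , r₁ , s₁ | c₂ , r₂ , s₂ = c₁ [ c₂ ]₀ , ⇒-[]₀ r₁ r₂ , ⇒-[]₀ s₁ s₂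

⇒-confluent : Confluent _⇒_
⇒-confluent = subcommutative⇒confluent λ p q → let c , r , s = ⇒-diamond p q in c , Refl.[ r ] , Refl.[ s ]

⇒-rename⁻¹ : ∀ {x u} → x ⇒ u → ∀ f t → rename f t ≡ x → ∃[ t′ ] t ⇒ t′ × u ≡ rename f t′
⇒-rename⁻¹ ⇒-con f t e with rename-con⁻¹ f t e
... | refl = t , ⇒-con , refl
⇒-rename⁻¹ ⇒-# f t e with rename-#⁻¹ f t e
... | j , refl , refl = # j , ⇒-# , refl
⇒-rename⁻¹ (⇒-ƛ p) f t e with rename-ƛ⁻¹ f t e
... | t₀ , refl , e₀ with ⇒-rename⁻¹ p (liftᵣ f) t₀ e₀
...   | t₀′ , q , refl = ƛ t₀′ , ⇒-ƛ q , refl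
⇒-rename⁻¹ (⇒-· p₁ p₂) f t e with rename-·⁻¹ f t e
... | t₁ , t₂ , refl , e₁ , e₂ with ⇒-rename⁻¹ p₁ f t₁ e₁ | ⇒-rename⁻¹ p₂ f t₂ e₂
...   | t₁′ , q₁ , refl | t₂′ , q₂ , refl = t₁′ · t₂′ , ⇒-· q₁ q₂ , refl
⇒-rename⁻¹ (⇒-β p₁ p₂) f t e with rename-·⁻¹ f t e
... | t₁ , t₂ , refl , e₁ , e₂ with rename-ƛ⁻¹ f t₁ e₁
...   | t₀ , refl , e₀ with ⇒-rename⁻¹ p₁ (liftᵣ f) t₀ e₀ | ⇒-rename⁻¹ p₂ f t₂ e₂
...     | t₀′ , q₁ , refl | t₂′ , q₂ , refl = t₀′ [ t₂′ ]₀ , ⇒-β q₁ q₂ , sym (rename-[]₀ f t₀′ t₂′)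

-- η-reduction

infix 4 _⟶η_
data _⟶η_ : Rel Term 0ℓ where
  -- the redex is given up to an equation, since weaken t is not a pattern
  η-top : ∀ {u t} → u ≡ weaken t → ƛ (u · # zero) ⟶η t
  η-ƛ   : ∀ {t t′} → t ⟶η t′ → ƛ t ⟶η ƛ t′
  η-·ˡ  : ∀ {t t′ u} → t ⟶η t′ → t · u ⟶η t′ · u
  η-·ʳ  : ∀ {t u u′} → u ⟶η u′ → t · u ⟶η t · u′

η-rename : ∀ f {t t′} → t ⟶η t′ → rename f t ⟶η rename f t′
η-rename f (η-top {t = t} refl) = η-top (rename-liftᵣ-weaken f t)
η-rename f (η-ƛ s)  = η-ƛ (η-rename (liftᵣ f) s)
η-rename f (η-·ˡ s) = η-·ˡ (η-rename f s)
η-rename f (η-·ʳ s) = η-·ʳ (η-rename f s)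

η-subst : ∀ σ {t t′} → t ⟶η t′ → subst σ t ⟶η subst σ t′
η-subst σ (η-top {t = t} refl) = η-top (subst-⇑-weaken σ t)
η-subst σ (η-ƛ s)  = η-ƛ (η-subst (⇑ σ) s)
η-subst σ (η-·ˡ s) = η-·ˡ (η-subst σ s)
η-subst σ (η-·ʳ s) = η-·ʳ (η-subst σ s)

η*-subst-pointwise : ∀ {σ τ} → (∀ i → Star _⟶η_ (σ i) (τ i)) → ∀ t → Star _⟶η_ (subst σ t) (subst τ t)
η*-subst-pointwise h (con c) = ε
η*-subst-pointwise h (# i)   = h i
η*-subst-pointwise h (ƛ t)   = gmap ƛ_ η-ƛ (η*-subst-pointwise ⇑h t)
  where
  ⇑h : ∀ i → Star _⟶η_ (⇑ _ i) (⇑ _ i)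
  ⇑h zero    = ε
  ⇑h (suc i) = gmap weaken (η-rename suc) (h i)
η*-subst-pointwise h (t · u) =
  gmap (_· _) η-·ˡ (η*-subst-pointwise h t) ◅◅ gmap (_ ·_) η-·ʳ (η*-subst-pointwise h u)

η-rename⁻¹ : ∀ {x u} → x ⟶η u → ∀ f t → rename f t ≡ x → ∃[ t′ ] t ⟶η t′ × u ≡ rename f t′
η-rename⁻¹ (η-top {t = v} e) f t e′ with rename-ƛ⁻¹ f t e′
... | s , refl , e₁ with rename-·⁻¹ (liftᵣ f) s e₁
...   | w , a , refl , e₂ , e₃ with rename-#⁻¹ (liftᵣ f) a e₃
...     | j , refl , e₄ with liftᵣ≡zero⁻¹ f e₄ | rename-liftᵣ≡weaken⁻¹ f w v (trans e₂ e)
...       | refl | v₀ , refl , refl = v₀ , η-top refl , refl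
η-rename⁻¹ (η-ƛ s) f t e with rename-ƛ⁻¹ f t e
... | t₀ , refl , e₀ with η-rename⁻¹ s (liftᵣ f) t₀ e₀
...   | t₀′ , q , refl = ƛ t₀′ , η-ƛ q , refl
η-rename⁻¹ (η-·ˡ s) f t e with rename-·⁻¹ f t e
... | t₁ , t₂ , refl , e₁ , refl with η-rename⁻¹ s f t₁ e₁
...   | t₁′ , q , refl = t₁′ · t₂ , η-·ˡ q , refl
η-rename⁻¹ (η-·ʳ s) f t e with rename-·⁻¹ f t e
... | t₁ , t₂ , refl , refl , e₂ with η-rename⁻¹ s f t₂ e₂
...   | t₂′ , q , refl = t₁ · t₂′ , η-·ʳ q , refl

η-subcommutative : Subcommutative _⟶η_
η-subcommutative (η-top e₁) (η-top e₂) with weaken-injective (trans (sym e₁) e₂)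
... | refl = -, Refl.refl , Refl.refl
η-subcommutative (η-top {t = t} e) (η-ƛ (η-·ˡ s)) with η-rename⁻¹ s suc t (sym e)
... | t′ , q , e′ = t′ , Refl.[ q ] , Refl.[ η-top e′ ]
η-subcommutative (η-top e) (η-ƛ (η-·ʳ ()))
η-subcommutative (η-ƛ (η-·ˡ s)) (η-top {t = t} e) with η-rename⁻¹ s suc t (sym e)
... | t′ , q , e′ = t′ , Refl.[ η-top e′ ] , Refl.[ q ]
η-subcommutative (η-ƛ (η-·ʳ ())) (η-top e)
η-subcommutative (η-ƛ s) (η-ƛ s′) with η-subcommutative s s′
... | d , o , o′ = ƛ d , Refl.map η-ƛ o , Refl.map η-ƛ o′
η-subcommutative (η-·ˡ s) (η-·ˡ s′) with η-subcommutative s s′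
... | d , o , o′ = d · _ , Refl.map η-·ˡ o , Refl.map η-·ˡ o′
η-subcommutative (η-·ˡ s) (η-·ʳ s′) = -, Refl.[ η-·ʳ s′ ] , Refl.[ η-·ˡ s ]
η-subcommutative (η-·ʳ s) (η-·ˡ s′) = -, Refl.[ η-·ˡ s′ ] , Refl.[ η-·ʳ s ]
η-subcommutative (η-·ʳ s) (η-·ʳ s′) with η-subcommutative s s′
... | d , o , o′ = _ · d , Refl.map η-·ʳ o , Refl.map η-·ʳ o′

η-confluent : Confluent _⟶η_
η-confluent = subcommutative⇒confluent η-subcommutative

-- βη-conversion

η-⇒-square : ∀ {a b c} → a ⟶η b → a ⇒ c → ∃[ d ] b ⇒ d × Star _⟶η_ c d
η-⇒-square (η-top {t = t} e) (⇒-ƛ (⇒-· p ⇒-#)) with ⇒-rename⁻¹ p suc t (sym e)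
... | t′ , q , e′ = t′ , q , return (η-top e′)
η-⇒-square (η-top {t = t} e) (⇒-ƛ (⇒-β p ⇒-#)) with rename-ƛ⁻¹ suc t (sym e)
... | t₀ , refl , e₀ with ⇒-rename⁻¹ p (liftᵣ suc) t₀ e₀
...   | t₀′ , q , refl = ƛ t₀′ , ⇒-ƛ q , ≡⇒* (cong ƛ_ (rename-liftᵣ-suc-[#0]₀ t₀′))
η-⇒-square (η-ƛ s) (⇒-ƛ p) with η-⇒-square s p
... | d , q , r = ƛ d , ⇒-ƛ q , gmap ƛ_ η-ƛ r
η-⇒-square (η-·ˡ s) (⇒-· p q) with η-⇒-square s p
... | d , p′ , r = d · _ , ⇒-· p′ q , gmap (_· _) η-·ˡ r
η-⇒-square (η-·ʳ s) (⇒-· p q) with η-⇒-square s q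
... | d , q′ , r = _ · d , ⇒-· p q′ , gmap (_ ·_) η-·ʳ r
η-⇒-square (η-·ˡ (η-top {t = t} e)) (⇒-β (⇒-· p ⇒-#) q) with ⇒-rename⁻¹ p suc t (sym e)
... | t′ , p′ , refl = t′ · _ , ⇒-· p′ q , ≡⇒* (cong (_· _) (weaken-[]₀ t′ _))
η-⇒-square (η-·ˡ (η-top {t = t} e)) (⇒-β (⇒-β p ⇒-#) q) with rename-ƛ⁻¹ suc t (sym e)
... | t₀ , refl , e₀ with ⇒-rename⁻¹ p (liftᵣ suc) t₀ e₀
...   | t₀′ , p′ , refl = t₀′ [ _ ]₀ , ⇒-β p′ q , ≡⇒* (cong (_[ _ ]₀) (rename-liftᵣ-suc-[#0]₀ t₀′))
η-⇒-square (η-·ˡ (η-ƛ s)) (⇒-β p q) with η-⇒-square s p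
... | d , p′ , r = d [ _ ]₀ , ⇒-β p′ q , gmap (_[ _ ]₀) (η-subst _) r
η-⇒-square (η-·ʳ s) (⇒-β {t′ = t′} {u′ = u′} p q) with η-⇒-square s q
... | d , q′ , r = t′ [ d ]₀ , ⇒-β p q′ , η*-subst-pointwise pointwise t′
  where
  pointwise : ∀ i → Star _⟶η_ ((u′ ∷ₛ #_) i) ((d ∷ₛ #_) i)
  pointwise zero    = r
  pointwise (suc i) = ε

infix 4 _⇒βη_ _≈_
_⇒βη_ : Rel Term 0ℓ
a ⇒βη c = ∃[ b ] Star _⇒_ a b × Star _⟶η_ b c

⇒βη-confluent : Confluent _⇒βη_
⇒βη-confluent =
  hindley-rosen ⇒-confluent η-confluent
    (strongly-commute⇒commute λ s p → let d , q , r = η-⇒-square s p in d , Refl.[ q ] , r)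

⇒βη-β : ∀ t u → (ƛ t) · u ⇒βη t [ u ]₀
⇒βη-β t u = -, return (⇒-β (⇒-refl t) (⇒-refl u)) , ε

⇒βη-η : ∀ {u t} → u ≡ weaken t → ƛ (u · # zero) ⇒βη t
⇒βη-η e = -, ε , return (η-top e)

⇒βη-ƛ : ∀ {a b} → a ⇒βη b → ƛ a ⇒βη ƛ b
⇒βη-ƛ (m , p , e) = ƛ m , gmap ƛ_ ⇒-ƛ p , gmap ƛ_ η-ƛ e

⇒βη-·ˡ : ∀ u {a b} → a ⇒βη b → a · u ⇒βη b · u
⇒βη-·ˡ u (m , p , e) = m · u , gmap (_· u) (λ r → ⇒-· r (⇒-refl u)) p , gmap (_· u) η-·ˡ e

⇒βη-·ʳ : ∀ t {a b} → a ⇒βη b → t · a ⇒βη t · b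
⇒βη-·ʳ t (m , p , e) = t · m , gmap (t ·_) (⇒-· (⇒-refl t)) p , gmap (t ·_) η-·ʳ e

_≈_ : Rel Term 0ℓ
_≈_ = EqClosure _⇒βη_

≈-ƛ : ∀ {a b} → a ≈ b → ƛ a ≈ ƛ b
≈-ƛ = EqClosure.gmap ƛ_ ⇒βη-ƛ

≈-· : ∀ {a b c d} → a ≈ b → c ≈ d → a · c ≈ b · d
≈-· {b = b} {c = c} p q = EqClosure.gmap (_· c) (⇒βη-·ˡ c) p ◅◅ EqClosure.gmap (b ·_) (⇒βη-·ʳ b) q

≡⇒≈ : ∀ {a b} → a ≡ b → a ≈ b
≡⇒≈ refl = ε

data Rigid : Term → Set where
  rigid-# : ∀ {i} → Rigid (# i)
  rigid-· : ∀ {t u} → Rigid t → Rigid (t · u)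

rigid-respects-⇒βη : Rigid Respects _⇒βη_
rigid-respects-⇒βη (_ , p , e) = star-respects η-respects e ∘ star-respects ⇒-respects p
  where
  ⇒-respects : Rigid Respects _⇒_
  ⇒-respects ⇒-#        rigid-#     = rigid-#
  ⇒-respects (⇒-· p q)  (rigid-· r) = rigid-· (⇒-respects p r)
  ⇒-respects (⇒-β p q)  (rigid-· ())
  η-respects : Rigid Respects _⟶η_
  η-respects (η-·ˡ s) (rigid-· r) = rigid-· (η-respects s r)
  η-respects (η-·ʳ s) (rigid-· r) = rigid-· r

con-respects-⇒βη : ∀ c → (_≡ con c) Respects _⇒βη_
con-respects-⇒βη c (_ , p , e) = star-respects η-respects e ∘ star-respects ⇒-respects p
  where
  ⇒-respects : (_≡ con c) Respects _⇒_
  ⇒-respects ⇒-con refl = refl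
  η-respects : (_≡ con c) Respects _⟶η_
  η-respects () refl

≈-con⁻¹ : ∀ {a c} → a ≈ con c → Star _⇒βη_ a (con c)
≈-con⁻¹ {c = c} a≈c with confluent⇒churchRosser ⇒βη-confluent a≈c
... | d , ad , cd with star-respects (con-respects-⇒βη c) cd refl
...   | refl = ad

con-≈-injective : ∀ {c c′} → con c ≈ con c′ → c ≡ c′
con-≈-injective c≈c′ with star-respects (con-respects-⇒βη _) (≈-con⁻¹ c≈c′) refl
... | refl = refl

rigid-≉-con : ∀ {a c} → Rigid a → ¬ a ≈ con c
rigid-≉-con r a≈c with star-respects rigid-respects-⇒βη (≈-con⁻¹ a≈c) r
... | ()

-- Erasure

erase : Subst → Exp → Term
erase ρ (sort k)       = con (sortᶜ k)
erase ρ (pi _ _ _ _ _) = con piᶜ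
erase ρ (var i)        = ρ i
erase ρ (lam rel U t)  = ƛ erase (⇑ ρ) t
erase ρ (lam irr U t)  = erase (con erasedᶜ ∷ₛ ρ) t
erase ρ (app rel t u)  = erase ρ t · erase ρ u
erase ρ (app irr t u)  = erase ρ t

erase-cong : ∀ {ρ ρ′} → ρ ≗ ρ′ → erase ρ ≗ erase ρ′
erase-cong p (sort k)       = refl
erase-cong p (pi _ _ _ _ _) = refl
erase-cong p (var i)        = p i
erase-cong p (lam rel U t)  = cong ƛ_ (erase-cong (⇑-cong p) t)
erase-cong p (lam irr U t)  = erase-cong (∷ₛ-cong (con erasedᶜ) p) t
erase-cong p (app rel t u)  = cong₂ _·_ (erase-cong p t) (erase-cong p u)
erase-cong p (app irr t u)  = erase-cong p t

erase-ren : ∀ ρ f t → erase ρ (ren f t) ≡ erase (ρ ∘ f) t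
erase-ren ρ f (sort k)       = refl
erase-ren ρ f (pi _ _ _ _ _) = refl
erase-ren ρ f (var i)        = refl
erase-ren ρ f (lam rel U t)  =
  cong ƛ_ (trans (erase-ren (⇑ ρ) (liftᵣ f) t) (erase-cong (∷ₛ-∘-liftᵣ (# zero) (weaken ∘ ρ) f) t))
erase-ren ρ f (lam irr U t)  =
  trans (erase-ren (con erasedᶜ ∷ₛ ρ) (liftᵣ f) t) (erase-cong (∷ₛ-∘-liftᵣ (con erasedᶜ) ρ f) t)
erase-ren ρ f (app rel t u)  = cong₂ _·_ (erase-ren ρ f t) (erase-ren ρ f u)
erase-ren ρ f (app irr t u)  = erase-ren ρ f t

rename-erase : ∀ g ρ t → rename g (erase ρ t) ≡ erase (rename g ∘ ρ) t
rename-erase g ρ (sort k)       = refl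
rename-erase g ρ (pi _ _ _ _ _) = refl
rename-erase g ρ (var i)        = refl
rename-erase g ρ (lam rel U t)  =
  cong ƛ_ (trans (rename-erase (liftᵣ g) (⇑ ρ) t) (erase-cong (rename-⇑ g ρ) t))
rename-erase g ρ (lam irr U t)  =
  trans (rename-erase g (con erasedᶜ ∷ₛ ρ) t) (erase-cong (∘-∷ₛ (rename g) (con erasedᶜ) ρ) t)
rename-erase g ρ (app rel t u)  = cong₂ _·_ (rename-erase g ρ t) (rename-erase g ρ u)
rename-erase g ρ (app irr t u)  = rename-erase g ρ t

subst-erase : ∀ τ ρ t → subst τ (erase ρ t) ≡ erase (subst τ ∘ ρ) t
subst-erase τ ρ (sort k)       = refl
subst-erase τ ρ (pi _ _ _ _ _) = refl
subst-erase τ ρ (var i)        = refl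
subst-erase τ ρ (lam rel U t)  =
  cong ƛ_ (trans (subst-erase (⇑ τ) (⇑ ρ) t) (erase-cong (subst-⇑ τ ρ) t))
subst-erase τ ρ (lam irr U t)  =
  trans (subst-erase τ (con erasedᶜ ∷ₛ ρ) t) (erase-cong (∘-∷ₛ (subst τ) (con erasedᶜ) ρ) t)
subst-erase τ ρ (app rel t u)  = cong₂ _·_ (subst-erase τ ρ t) (subst-erase τ ρ u)
subst-erase τ ρ (app irr t u)  = subst-erase τ ρ t

erase-⇑-wk : ∀ ρ t → erase (⇑ ρ) (wk t) ≡ weaken (erase ρ t)
erase-⇑-wk ρ t = trans (erase-ren (⇑ ρ) suc t) (sym (rename-erase suc ρ t))

erase-∷ₛ-wk : ∀ x ρ t → erase (x ∷ₛ ρ) (wk t) ≡ erase ρ t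
erase-∷ₛ-wk x ρ = erase-ren (x ∷ₛ ρ) suc

erase-sub : ∀ ρ σ t → erase ρ (sub σ t) ≡ erase (erase ρ ∘ σ) t
erase-sub ρ σ (sort k)       = refl
erase-sub ρ σ (pi _ _ _ _ _) = refl
erase-sub ρ σ (var i)        = refl
erase-sub ρ σ (lam rel U t)  = cong ƛ_ (trans (erase-sub (⇑ ρ) (liftₛ σ) t) (erase-cong pointwise t))
  where
  pointwise : erase (⇑ ρ) ∘ liftₛ σ ≗ ⇑ (erase ρ ∘ σ)
  pointwise zero    = refl
  pointwise (suc i) = erase-⇑-wk ρ (σ i)
erase-sub ρ σ (lam irr U t)  = trans (erase-sub (con erasedᶜ ∷ₛ ρ) (liftₛ σ) t) (erase-cong pointwise t)
  where
  pointwise : erase (con erasedᶜ ∷ₛ ρ) ∘ liftₛ σ ≗ (con erasedᶜ ∷ₛ erase ρ ∘ σ)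
  pointwise zero    = refl
  pointwise (suc i) = erase-∷ₛ-wk (con erasedᶜ) ρ (σ i)
erase-sub ρ σ (app rel t u)  = cong₂ _·_ (erase-sub ρ σ t) (erase-sub ρ σ u)
erase-sub ρ σ (app irr t u)  = erase-sub ρ σ t

erase-[] : ∀ ρ t u → erase ρ (t [ u ]) ≡ erase (⇑ ρ) t [ erase ρ u ]₀
erase-[] ρ t u = begin
  erase ρ (t [ u ])                                      ≡⟨ erase-sub ρ (single u) t ⟩
  erase (erase ρ ∘ single u) t                           ≡⟨ erase-cong pointwise t ⟩
  erase (subst (erase ρ u ∷ₛ #_) ∘ ⇑ ρ) t                ≡⟨ sym (subst-erase (erase ρ u ∷ₛ #_) (⇑ ρ) t) ⟩
  erase (⇑ ρ) t [ erase ρ u ]₀                           ∎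
  where
  open ≡-Reasoning
  pointwise : erase ρ ∘ single u ≗ subst (erase ρ u ∷ₛ #_) ∘ ⇑ ρ
  pointwise zero    = refl
  pointwise (suc i) = sym (weaken-[]₀ (ρ i) (erase ρ u))

data Clean : (ℕ → Ann) → Exp → Set where
  clean-sort    : ∀ {m k} → Clean m (sort k)
  clean-pi      : ∀ {m a s s′ U T} → Clean m (pi a s s′ U T)
  clean-var     : ∀ {m i} → m i ≡ rel → Clean m (var i)
  clean-lam     : ∀ {m a U t} → Clean (a ∷ₛ m) t → Clean m (lam a U t)
  clean-app-rel : ∀ {m t u} → Clean m t → Clean m u → Clean m (app rel t u)
  clean-app-irr : ∀ {m t u} → Clean m t → Clean m (app irr t u)

AgreeOnRelevant : (ℕ → Ann) → Subst → Subst → Set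
AgreeOnRelevant m ρ ρ′ = ∀ i → m i ≡ rel → ρ i ≡ ρ′ i

∷ₛ-agree : ∀ {m ρ ρ′} a x → AgreeOnRelevant m ρ ρ′ → AgreeOnRelevant (a ∷ₛ m) (x ∷ₛ ρ) (x ∷ₛ ρ′)
∷ₛ-agree a x h zero    _ = refl
∷ₛ-agree a x h (suc i) e = h i e

clean-erase-agree : ∀ {m t} → Clean m t → ∀ {ρ ρ′} → AgreeOnRelevant m ρ ρ′ → erase ρ t ≡ erase ρ′ t
clean-erase-agree clean-sort          h = refl
clean-erase-agree clean-pi            h = refl
clean-erase-agree (clean-var e)       h = h _ e
clean-erase-agree (clean-lam {a = rel} c) h =
  cong ƛ_ (clean-erase-agree c (∷ₛ-agree rel (# zero) λ i e → cong weaken (h i e)))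
clean-erase-agree (clean-lam {a = irr} c) h = clean-erase-agree c (∷ₛ-agree irr (con erasedᶜ) h)
clean-erase-agree (clean-app-rel c d) h = cong₂ _·_ (clean-erase-agree c h) (clean-erase-agree d h)
clean-erase-agree (clean-app-irr c)   h = clean-erase-agree c h

erase-[]-irr : ∀ {m} ρ t u → Clean (irr ∷ₛ m) t → erase (con erasedᶜ ∷ₛ ρ) t ≡ erase ρ (t [ u ])
erase-[]-irr ρ t u c = trans (clean-erase-agree c agree) (sym (erase-sub ρ (single u) t))
  where
  agree : AgreeOnRelevant (irr ∷ₛ _) (con erasedᶜ ∷ₛ ρ) (erase ρ ∘ single u)
  agree zero    ()
  agree (suc i) _ = refl

relevance : Ctx → ℕ → Ann
relevance ∅             _ = irr
relevance (Γ ▸ (a , _)) = a ∷ₛ relevance Γ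

∋-relevant : ∀ {Γ i U} → Γ ∋ i ∶ U → relevance Γ i ≡ rel
∋-relevant here      = refl
∋-relevant (there x) = ∋-relevant x

typed-clean : ∀ {Γ t T} → Γ ⊢ t ∶ T → Clean (relevance Γ) t
typed-clean (t-sort _)           = clean-sort
typed-clean (t-pi _ _)           = clean-pi
typed-clean (t-var _ x)          = clean-var (∋-relevant x)
typed-clean (t-lam d _)          = clean-lam (typed-clean d)
typed-clean (t-app {a = rel} d e) = clean-app-rel (typed-clean d) (typed-clean e)
typed-clean (t-app {a = irr} d _) = clean-app-irr (typed-clean d)
typed-clean (t-conv d _)         = typed-clean d

erase-sound : ∀ {Γ t t′ T} → Γ ⊢ t ≣ t′ ∶ T → ∀ ρ → erase ρ t ≈ erase ρ t′
erase-sound (e-β {a = rel} {t = t} {u = u} _ _) ρ =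
  EqClosure.return (⇒βη-β (erase (⇑ ρ) t) (erase ρ u)) ◅◅ ≡⇒≈ (sym (erase-[] ρ t u))
erase-sound (e-β {a = irr} {t = t} {u = u} d _) ρ = ≡⇒≈ (erase-[]-irr ρ t u (typed-clean d))
erase-sound (e-η {a = rel} {t = t} _) ρ = EqClosure.symmetric _ (EqClosure.return (⇒βη-η (erase-⇑-wk ρ t)))
erase-sound (e-η {a = irr} {t = t} _) ρ = ≡⇒≈ (sym (erase-∷ₛ-wk (con erasedᶜ) ρ t))
erase-sound (e-refl _)       ρ = ε
erase-sound (e-sym d)        ρ = EqClosure.symmetric _ (erase-sound d ρ)
erase-sound (e-trans d d′)   ρ = erase-sound d ρ ◅◅ erase-sound d′ ρ
erase-sound (e-pi _ _)       ρ = ε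
erase-sound (e-lam {a = rel} _ _ d) ρ = ≈-ƛ (erase-sound d (⇑ ρ))
erase-sound (e-lam {a = irr} _ _ d) ρ = erase-sound d (con erasedᶜ ∷ₛ ρ)
erase-sound (e-app {a = rel} d (eq-rel e)) ρ = ≈-· (erase-sound d ρ) (erase-sound e ρ)
erase-sound (e-app {a = irr} d _) ρ = erase-sound d ρ
erase-sound (e-conv d _)     ρ = erase-sound d ρ

neutral-rigid : ∀ {N} → Neutral N → Rigid (erase #_ N)
neutral-rigid (ne-var i)         = rigid-#
neutral-rigid (ne-app {rel} u n) = rigid-· (neutral-rigid n)
neutral-rigid (ne-app {irr} u n) = neutral-rigid n

lemma5p10 : (Γ : Ctx) (N : Exp) → Neutral N →
    ((s s'' : ℕ) → ¬ (Γ ⊢ N ≣ sort s ∶ sort s''))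
    × ((a : Ann) (s₁ s₂ : ℕ) (U T : Exp) (s'' : ℕ) → ¬ (Γ ⊢ N ≣ pi a s₁ s₂ U T ∶ sort s''))
    × ((s s' s'' : ℕ) → Γ ⊢ sort s ≣ sort s' ∶ sort s'' → s ≡ s')
    × ((s : ℕ) (a : Ann) (s₁ s₂ : ℕ) (U T : Exp) (s'' : ℕ) → ¬ (Γ ⊢ sort s ≣ pi a s₁ s₂ U T ∶ sort s''))
lemma5p10 Γ N n =
    (λ _ _ N≡s → rigid-≉-con (neutral-rigid n) (erase-sound N≡s #_))
  , (λ _ _ _ _ _ _ N≡Π → rigid-≉-con (neutral-rigid n) (erase-sound N≡Π #_))
  , (λ _ _ _ s≡s′ → sortᶜ-injective (con-≈-injective (erase-sound s≡s′ #_)))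
  , (λ _ _ _ _ _ _ _ s≡Π → sortᶜ≢piᶜ (con-≈-injective (erase-sound s≡Π #_)))
  where
  sortᶜ-injective : ∀ {s s′} → sortᶜ s ≡ sortᶜ s′ → s ≡ s′
  sortᶜ-injective refl = refl
  sortᶜ≢piᶜ : ∀ {s} → sortᶜ s ≢ piᶜ
  sortᶜ≢piᶜ ()
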